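{- For microCCS processes $P,Q$, if $P\sim Q$ then $c_\eta(P)=c_\eta(Q)$ for every prefix $\eta$.
   Context: MicroCCS processes: $\eta ::= a \mid \overline{a}$ (names $a$), $P ::= \mathbf{0} \mid \eta.P \mid P|Q$. Transitions: $\eta.P\xrightarrow{\eta}P$; if $P\xrightarrow{\eta}P'$, $Q\xrightarrow{\overline\eta}Q'$ then $P|Q\xrightarrow{\tau}P'|Q'$; if $P\xrightarrow{\mu}P'$ then $P|Q\xrightarrow{\mu}P'|Q$ and $Q|P\xrightarrow{\mu}Q|P'$. Strong bisimilarity $\sim$ is the union of all symmetric relations $\mathcal R$ such that $P\mathcal RQ$, $P\xrightarrow{\mu}P'$ imply $Q\xrightarrow{\mu}Q'$ with $P'\mathcal RQ'$. Size: $|\mathbf 0|=0$, $|P_1|P_2|=|P_1|+|P_2|$, $|\eta.P|=1+|P|$. The contribution of $P$ at $\eta$ is $c_\eta(\mathbf 0)=0$, $c_\eta(P_1|P_2)=c_\eta(P_1)+c_\eta(P_2)$, $c_\eta(\eta'.P)=0$ if $\eta'\neq\eta$, $c_\eta(\eta.P)=|\eta.P|$. -}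

module Defs where

open import Data.Nat using (ℕ; zero; suc; _+_)
import Data.Nat
open import Data.Bool using (Bool; true; false)
open import Data.Product using (Σ; ∃; _×_; _,_)
open import Relation.Nullary using (Dec; yes; no)
open import Relation.Binary.PropositionalEquality using (_≡_)

Name : Set
Name = ℕ

data Prefix : Set where
  nm  : Name → Prefix
  co  : Name → Prefix

bar : Prefix → Prefix
bar (nm a) = co a
bar (co a) = nm a

_≟ₚ_ : (x y : Prefix) → Dec (x ≡ y)
nm a ≟ₚ nm b with a Data.Nat.≟ b
... | yes Relation.Binary.PropositionalEquality.refl = yes Relation.Binary.PropositionalEquality.refl
... | no ne = no λ { Relation.Binary.PropositionalEquality.refl → ne Relation.Binary.PropositionalEquality.refl }
nm a ≟ₚ co b = no λ ()
co a ≟ₚ nm b = no λ ()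
co a ≟ₚ co b with a Data.Nat.≟ b
... | yes Relation.Binary.PropositionalEquality.refl = yes Relation.Binary.PropositionalEquality.refl
... | no ne = no λ { Relation.Binary.PropositionalEquality.refl → ne Relation.Binary.PropositionalEquality.refl }

data Act : Set where
  pre : Prefix → Act
  τ   : Act

data Proc : Set where
  𝟎    : Proc
  _∙_  : Prefix → Proc → Proc
  _∥_  : Proc → Proc → Proc

infixr 6 _∙_
infixl 5 _∥_

data _─[_]→_ : Proc → Act → Proc → Set where
  pref : ∀ {η P} → (η ∙ P) ─[ pre η ]→ P
  com  : ∀ {η P P' Q Q'} → P ─[ pre η ]→ P' → Q ─[ pre (bar η) ]→ Q' →
         (P ∥ Q) ─[ τ ]→ (P' ∥ Q')
  parL : ∀ {μ P P' Q} → P ─[ μ ]→ P' → (P ∥ Q) ─[ μ ]→ (P' ∥ Q)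
  parR : ∀ {μ P P' Q} → P ─[ μ ]→ P' → (Q ∥ P) ─[ μ ]→ (Q ∥ P')

Symmetric : (Proc → Proc → Set) → Set
Symmetric R = ∀ {P Q} → R P Q → R Q P

IsSimulation : (Proc → Proc → Set) → Set
IsSimulation R = ∀ {P Q μ P'} → R P Q → P ─[ μ ]→ P' →
                 ∃ λ Q' → (Q ─[ μ ]→ Q') × R P' Q'

_∼_ : Proc → Proc → Set₁
P ∼ Q = Σ (Proc → Proc → Set) λ R → Symmetric R × IsSimulation R × R P Q

size : Proc → ℕ
size 𝟎 = 0
size (P ∥ Q) = size P + size Q
size (η ∙ P) = suc (size P)

c : Prefix → Proc → ℕ
c η 𝟎 = 0
c η (P ∥ Q) = c η P + c η Q
c η (η' ∙ P) with η' ≟ₚ η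
... | yes _ = size (η' ∙ P)
... | no _ = 0

{-# OPTIONS --safe #-}

-- Fix η and give each prefix occurrence ζ.T of a process, at any depth, the integer weight
-- c_η(ζ.T) − c_η(T). The weights telescope, so c_η(P) is the sum of the multiset of weights of P
-- and |P| its cardinality, and a visible move removes exactly the weight of the fired prefix.
-- By induction on size, bisimilar processes have the same weight multiset: matched moves
-- P → P′, Q → Q′ have equal residual multisets, so only the fired weights a and b must agree.
-- If a ≠ b, counting occurrences of a shows that every move of P fires weight a. A weight is
-- positive exactly when its prefix is η, so either all moves of P and Q are η-moves or none is;
-- then c_η(P) = c_η(Q) (both are the size, or both 0), and comparing with the residuals gives a = b.

module Submission where

open import Defs
open import Relation.Binary.PropositionalEquality using (_≡_)

open import Algebra.Bundles using (AbelianGroup)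
import Algebra.Properties.Group
open import Data.Bool.Base using (true; false; if_then_else_)
open import Data.Integer.Base as ℤ using (ℤ; +_; 0ℤ; _+_; _-_)
import Data.Integer.Properties as ℤ
open import Data.Integer.Tactic.RingSolver using (solve-∀)
open import Data.List.Base using (List; []; _∷_; _++_; length; filter; foldr)
open import Data.List.Properties using (length-++; filter-accept; filter-reject)
open import Data.List.Relation.Binary.Permutation.Propositional
  using (_↭_; ↭-refl; ↭-sym; ↭-trans; ↭-reflexive; prep; ↭⇒↭ₛ; module PermutationReasoning)
open import Data.List.Relation.Binary.Permutation.Propositional.Properties
  using (↭-length; filter-↭; ++⁺ʳ; ++⁺ˡ; shift; ¬x∷xs↭[])
import Data.List.Relation.Binary.Permutation.Setoid.Properties as Permutationₛ
open import Data.Nat.Base using (ℕ; suc; _∸_; _≤_; _<_; z≤n; s≤s) renaming (_+_ to _+ℕ_)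
open import Data.Nat.Induction using (<-wellFounded)
open import Data.Nat.Properties
  using ( ≤-refl; ≤-reflexive; ≤-trans; n≤1+n; m≤n⇒m≤1+n; n≮n; +-mono-≤; +-∸-assoc
        ; module ≤-Reasoning)
open import Data.Product.Base using (∃; ∃₂; _×_; _,_; proj₁; proj₂)
open import Data.Sum.Base using (_⊎_; inj₁; inj₂)
open import Function.Base using (_on_; case_of_)
open import Induction.WellFounded using (Acc; acc)
open import Relation.Binary.Construct.On using (wellFounded)
open import Relation.Binary.Definitions using (DecidableEquality)
open import Relation.Binary.PropositionalEquality
  using (_≢_; refl; sym; trans; cong; cong₂; subst; setoid; module ≡-Reasoning)
open import Relation.Nullary using (¬_; yes; no; does; contradiction)
open import Relation.Nullary.Decidable using (dec-true; dec-false)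

module _ {A : Set} (_≟_ : DecidableEquality A) where

  count : A → List A → ℕ
  count x xs = length (filter (_≟ x) xs)

  count-↭ : ∀ x {xs ys} → xs ↭ ys → count x xs ≡ count x ys
  count-↭ x p = ↭-length (filter-↭ (_≟ x) p)

  count-here : ∀ x xs → count x (x ∷ xs) ≡ suc (count x xs)
  count-here x xs = cong length (filter-accept (_≟ x) refl)

  count-there : ∀ {x y} xs → y ≢ x → count x (y ∷ xs) ≡ count x xs
  count-there {x} xs y≢x = cong length (filter-reject (_≟ x) y≢x)

  count-≤-∷ : ∀ x y xs → count x xs ≤ count x (y ∷ xs)
  count-≤-∷ x y xs = case y ≟ x of λ where
    (yes refl) → ≤-trans (n≤1+n _) (≤-reflexive (sym (count-here x xs)))
    (no y≢x)   → ≤-reflexive (sym (count-there xs y≢x))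

  ∷-↭-exchange : ∀ {a a′ b b′ xs ys} → a ∷ xs ↭ a′ ∷ ys → b ∷ xs ↭ b′ ∷ ys → a ≢ b → a ≡ a′
  ∷-↭-exchange {a} {a′} {b} {b′} {xs} {ys} p q a≢b with a′ ≟ a
  ... | yes a′≡a = sym a′≡a
  ... | no a′≢a  = contradiction (begin-strict
    count a ys        ≤⟨ count-≤-∷ a b′ ys ⟩
    count a (b′ ∷ ys) ≡⟨ count-↭ a q ⟨
    count a (b ∷ xs)  ≡⟨ count-there xs (λ b≡a → a≢b (sym b≡a)) ⟩
    count a xs        <⟨ ≤-refl ⟩
    suc (count a xs)  ≡⟨ count-here a xs ⟨
    count a (a ∷ xs)  ≡⟨ count-↭ a p ⟩
    count a (a′ ∷ ys) ≡⟨ count-there ys a′≢a ⟩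
    count a ys        ∎) (n≮n (count a ys))
    where open ≤-Reasoning

sumℤ : List ℤ → ℤ
sumℤ = foldr _+_ 0ℤ

sumℤ-++ : ∀ xs ys → sumℤ (xs ++ ys) ≡ sumℤ xs + sumℤ ys
sumℤ-++ []       ys = sym (ℤ.+-identityˡ (sumℤ ys))
sumℤ-++ (x ∷ xs) ys = begin
  x + sumℤ (xs ++ ys)        ≡⟨ cong (_+_ x) (sumℤ-++ xs ys) ⟩
  x + (sumℤ xs + sumℤ ys)    ≡⟨ ℤ.+-assoc x _ _ ⟨
  (x + sumℤ xs) + sumℤ ys    ∎
  where open ≡-Reasoning

sumℤ-↭ : ∀ {xs ys} → xs ↭ ys → sumℤ xs ≡ sumℤ ys
sumℤ-↭ p = Permutationₛ.foldr-commMonoid (setoid ℤ) ℤ.+-0-isCommutativeMonoid (↭⇒↭ₛ p)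

i-j+j≡i : ∀ i j → i - j + j ≡ i
i-j+j≡i = solve-∀

+-cancelʳ-≡ : ∀ {i j} k → i + k ≡ j + k → i ≡ j
+-cancelʳ-≡ k = ∙-cancelʳ k _ _
  where open Algebra.Properties.Group (AbelianGroup.group ℤ.+-0-abelianGroup) using (∙-cancelʳ)

0<1+m-n : ∀ {m n} → n ≤ m → 0ℤ ℤ.< + suc m - + n
0<1+m-n {m} {n} n≤m = subst (0ℤ ℤ.<_) (sym 1+m-n≡1+[m∸n]) (ℤ.+<+ (s≤s z≤n))
  where
  1+m-n≡1+[m∸n] : + suc m - + n ≡ + suc (m ∸ n)
  1+m-n≡1+[m∸n] = begin
    + suc m - + n    ≡⟨ ℤ.m-n≡m⊖n (suc m) n ⟩
    suc m ℤ.⊖ n      ≡⟨ ℤ.⊖-≥ (m≤n⇒m≤1+n n≤m) ⟩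
    + (suc m ∸ n)    ≡⟨ cong +_ (+-∸-assoc 1 n≤m) ⟩
    + suc (m ∸ n)    ∎
    where open ≡-Reasoning

c≤size : ∀ η X → c η X ≤ size X
c≤size η 𝟎 = z≤n
c≤size η (ζ ∙ T) with ζ ≟ₚ η
... | yes _ = ≤-refl
... | no _  = z≤n
c≤size η (A ∥ B) = +-mono-≤ (c≤size η A) (c≤size η B)

c-uniform : ∀ η {s} X → (∀ {ζ X′} → X ─[ pre ζ ]→ X′ → does (ζ ≟ₚ η) ≡ s) →
            c η X ≡ (if s then size X else 0)
c-uniform η {true}  𝟎 _ = refl
c-uniform η {false} 𝟎 _ = refl
c-uniform η (ζ ∙ T) uniform with ζ ≟ₚ η | uniform pref
... | yes _ | refl = refl
... | no _  | refl = refl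
c-uniform η {true}  (A ∥ B) uniform =
  cong₂ _+ℕ_ (c-uniform η A (λ t → uniform (parL t))) (c-uniform η B (λ t → uniform (parR t)))
c-uniform η {false} (A ∥ B) uniform =
  cong₂ _+ℕ_ (c-uniform η A (λ t → uniform (parL t))) (c-uniform η B (λ t → uniform (parR t)))

Move : Proc → Set
Move X = ∃₂ λ ζ X′ → X ─[ pre ζ ]→ X′

fired : ∀ {X ζ X′} → X ─[ pre ζ ]→ X′ → Proc
fired (pref {P = T}) = T
fired (parL t)       = fired t
fired (parR t)       = fired t

module Weights (η : Prefix) where

  weight : Prefix → Proc → ℤ
  weight ζ T = + c η (ζ ∙ T) - + c η T

  weights : Proc → List ℤ
  weights 𝟎       = []
  weights (ζ ∙ T) = weight ζ T ∷ weights T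
  weights (A ∥ B) = weights A ++ weights B

  length-weights : ∀ X → length (weights X) ≡ size X
  length-weights 𝟎       = refl
  length-weights (ζ ∙ T) = cong suc (length-weights T)
  length-weights (A ∥ B) =
    trans (length-++ (weights A)) (cong₂ _+ℕ_ (length-weights A) (length-weights B))

  sumℤ-weights : ∀ X → sumℤ (weights X) ≡ + c η X
  sumℤ-weights 𝟎       = refl
  sumℤ-weights (ζ ∙ T) =
    trans (cong (_+_ (weight ζ T)) (sumℤ-weights T)) (i-j+j≡i (+ c η (ζ ∙ T)) (+ c η T))
  sumℤ-weights (A ∥ B) = begin
    sumℤ (weights A ++ weights B)             ≡⟨ sumℤ-++ (weights A) (weights B) ⟩
    sumℤ (weights A) + sumℤ (weights B)       ≡⟨ cong₂ _+_ (sumℤ-weights A) (sumℤ-weights B) ⟩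
    + c η A + + c η B                         ≡⟨ ℤ.pos-+ (c η A) (c η B) ⟨
    + c η (A ∥ B)                             ∎
    where open ≡-Reasoning

  size-≡ : ∀ X Y → weights X ↭ weights Y → size X ≡ size Y
  size-≡ X Y p = trans (sym (length-weights X)) (trans (↭-length p) (length-weights Y))

  c-≡ : ∀ X Y → weights X ↭ weights Y → c η X ≡ c η Y
  c-≡ X Y p = ℤ.+-injective (trans (sym (sumℤ-weights X)) (trans (sumℤ-↭ p) (sumℤ-weights Y)))

  weightOf : ∀ {X ζ X′} → X ─[ pre ζ ]→ X′ → ℤ
  weightOf {ζ = ζ} t = weight ζ (fired t)

  weights-fire : ∀ {X ζ X′} (t : X ─[ pre ζ ]→ X′) → weights X ↭ weightOf t ∷ weights X′
  weights-fire pref             = ↭-refl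
  weights-fire (parL {Q = B} t) = ++⁺ʳ (weights B) (weights-fire t)
  weights-fire (parR {Q = B} t) =
    ↭-trans (++⁺ˡ (weights B) (weights-fire t)) (shift _ (weights B) _)

  size-fire : ∀ {X ζ X′} → X ─[ pre ζ ]→ X′ → size X ≡ suc (size X′)
  size-fire {X} {X′ = X′} t = begin
    size X                       ≡⟨ length-weights X ⟨
    length (weights X)           ≡⟨ ↭-length (weights-fire t) ⟩
    suc (length (weights X′))    ≡⟨ cong suc (length-weights X′) ⟩
    suc (size X′)                ∎
    where open ≡-Reasoning

  c-fire : ∀ {X ζ X′} (t : X ─[ pre ζ ]→ X′) → + c η X ≡ weightOf t + + c η X′
  c-fire {X} {X′ = X′} t = begin
    + c η X                           ≡⟨ sumℤ-weights X ⟨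
    sumℤ (weights X)                  ≡⟨ sumℤ-↭ (weights-fire t) ⟩
    weightOf t + sumℤ (weights X′)    ≡⟨ cong (_+_ (weightOf t)) (sumℤ-weights X′) ⟩
    weightOf t + + c η X′             ∎
    where open ≡-Reasoning

  inert : ∀ {X ζ X′} → weights X ≡ [] → ¬ X ─[ pre ζ ]→ X′
  inert e t = ¬x∷xs↭[] (↭-trans (↭-sym (weights-fire t)) (↭-reflexive e))

  inert⊎move : ∀ X → weights X ≡ [] ⊎ Move X
  inert⊎move 𝟎       = inj₁ refl
  inert⊎move (ζ ∙ T) = inj₂ (ζ , T , pref)
  inert⊎move (A ∥ B) with inert⊎move A | inert⊎move B
  ... | inj₂ (ζ , A′ , t) | _                 = inj₂ (ζ , A′ ∥ B , parL t)
  ... | inj₁ _            | inj₂ (ζ , B′ , t) = inj₂ (ζ , A ∥ B′ , parR t)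
  ... | inj₁ eA           | inj₁ eB           = inj₁ (cong₂ _++_ eA eB)

  η-status-by-weight : ∀ ζ T → does (ζ ≟ₚ η) ≡ does (0ℤ ℤ.<? weight ζ T)
  η-status-by-weight ζ T with ζ ≟ₚ η
  ... | yes refl = sym (dec-true (0ℤ ℤ.<? _) (0<1+m-n (c≤size ζ T)))
  ... | no _     = sym (dec-false (0ℤ ℤ.<? _) (ℤ.≤⇒≯ (ℤ.i≤j⇒i-j≤0 {j = + c η T} (ℤ.+≤+ z≤n))))

  η-status-resp-weight : ∀ {X ζ X′ Y ξ Y′} (t : X ─[ pre ζ ]→ X′) (u : Y ─[ pre ξ ]→ Y′) →
                         weightOf t ≡ weightOf u → does (ζ ≟ₚ η) ≡ does (ξ ≟ₚ η)
  η-status-resp-weight {ζ = ζ} {ξ = ξ} t u w≡w′ = begin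
    does (ζ ≟ₚ η)                ≡⟨ η-status-by-weight ζ (fired t) ⟩
    does (0ℤ ℤ.<? weightOf t)    ≡⟨ cong (λ w → does (0ℤ ℤ.<? w)) w≡w′ ⟩
    does (0ℤ ℤ.<? weightOf u)    ≡⟨ η-status-by-weight ξ (fired u) ⟨
    does (ξ ≟ₚ η)                ∎
    where open ≡-Reasoning

  MatchedBy : Proc → Proc → Set
  MatchedBy P Q = ∀ {ζ P′} → P ─[ pre ζ ]→ P′ → ∃ λ Q′ → Q ─[ pre ζ ]→ Q′ × weights P′ ↭ weights Q′

  unequal-match⇒uniform-weight :
    ∀ {P Q} → MatchedBy P Q →
    ∀ {ζ P′ Q′} (t : P ─[ pre ζ ]→ P′) (u : Q ─[ pre ζ ]→ Q′) → weights P′ ↭ weights Q′ →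
    weightOf t ≢ weightOf u → ∀ {ζ₂ P₂} (t₂ : P ─[ pre ζ₂ ]→ P₂) → weightOf t ≡ weightOf t₂
  unequal-match⇒uniform-weight {Q = Q} P≼Q {P′ = P′} {Q′} t u P′↭Q′ a≢b {P₂ = P₂} t₂
    with P≼Q t₂
  ... | Q₂ , u₂ , P₂↭Q₂ = ∷-↭-exchange ℤ._≟_ via-P via-Q a≢b
    where
    open PermutationReasoning
    via-P : weightOf t ∷ weights P′ ↭ weightOf t₂ ∷ weights P₂
    via-P = ↭-trans (↭-sym (weights-fire t)) (weights-fire t₂)
    via-Q : weightOf u ∷ weights P′ ↭ weightOf u₂ ∷ weights P₂
    via-Q = begin
      weightOf u ∷ weights P′    ↭⟨ prep _ P′↭Q′ ⟩
      weightOf u ∷ weights Q′    ↭⟨ weights-fire u ⟨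
      weights Q                  ↭⟨ weights-fire u₂ ⟩
      weightOf u₂ ∷ weights Q₂   ↭⟨ prep _ (↭-sym P₂↭Q₂) ⟩
      weightOf u₂ ∷ weights P₂   ∎

  matched-weights-≡ : ∀ {P Q} → MatchedBy P Q → MatchedBy Q P →
                      ∀ {ζ P′ Q′} (t : P ─[ pre ζ ]→ P′) (u : Q ─[ pre ζ ]→ Q′) →
                      weights P′ ↭ weights Q′ → weightOf t ≡ weightOf u
  matched-weights-≡ {P} {Q} P≼Q Q≼P {ζ} {P′} {Q′} t u P′↭Q′ with weightOf t ℤ.≟ weightOf u
  ... | yes a≡b = a≡b
  ... | no a≢b  = +-cancelʳ-≡ (+ c η P′) shifted
    where
    uniform-P : ∀ {ζ₂ P₂} → P ─[ pre ζ₂ ]→ P₂ → does (ζ₂ ≟ₚ η) ≡ does (ζ ≟ₚ η)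
    uniform-P t₂ =
      sym (η-status-resp-weight t t₂ (unequal-match⇒uniform-weight P≼Q t u P′↭Q′ a≢b t₂))

    uniform-Q : ∀ {ζ₂ Q₂} → Q ─[ pre ζ₂ ]→ Q₂ → does (ζ₂ ≟ₚ η) ≡ does (ζ ≟ₚ η)
    uniform-Q u₂ = uniform-P (proj₁ (proj₂ (Q≼P u₂)))

    size-P≡size-Q : size P ≡ size Q
    size-P≡size-Q = trans (size-fire t) (trans (cong suc (size-≡ P′ Q′ P′↭Q′)) (sym (size-fire u)))

    c-P≡c-Q : c η P ≡ c η Q
    c-P≡c-Q = trans (c-uniform η P uniform-P)
             (trans (cong (λ n → if does (ζ ≟ₚ η) then n else 0) size-P≡size-Q)
                    (sym (c-uniform η Q uniform-Q)))

    shifted : weightOf t + + c η P′ ≡ weightOf u + + c η P′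
    shifted = begin
      weightOf t + + c η P′   ≡⟨ c-fire t ⟨
      + c η P                 ≡⟨ cong +_ c-P≡c-Q ⟩
      + c η Q                 ≡⟨ c-fire u ⟩
      weightOf u + + c η Q′   ≡⟨ cong (λ n → weightOf u + + n) (c-≡ P′ Q′ P′↭Q′) ⟨
      weightOf u + + c η P′   ∎
      where open ≡-Reasoning

  weights-↭ : ∀ {P Q} → MatchedBy P Q → MatchedBy Q P → weights P ↭ weights Q
  weights-↭ {P} {Q} P≼Q Q≼P with inert⊎move P
  ... | inj₂ (_ , P′ , t) with P≼Q t
  ...   | Q′ , u , P′↭Q′ = begin
    weights P                  ↭⟨ weights-fire t ⟩
    weightOf t ∷ weights P′    ≡⟨ cong (_∷ weights P′) (matched-weights-≡ P≼Q Q≼P t u P′↭Q′) ⟩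
    weightOf u ∷ weights P′    ↭⟨ prep _ P′↭Q′ ⟩
    weightOf u ∷ weights Q′    ↭⟨ weights-fire u ⟨
    weights Q                  ∎
    where open PermutationReasoning
  weights-↭ {P} {Q} P≼Q Q≼P | inj₁ P-inert with inert⊎move Q
  ... | inj₁ Q-inert      = ↭-reflexive (trans P-inert (sym Q-inert))
  ... | inj₂ (_ , _ , u) = contradiction (proj₁ (proj₂ (Q≼P u))) (inert P-inert)

  module _ {R : Proc → Proc → Set} (R-sym : Symmetric R) (R-sim : IsSimulation R) where

    bisimilar⇒weights-↭ : ∀ {P Q} → Acc (_<_ on size) P → R P Q → weights P ↭ weights Q
    bisimilar⇒weights-↭ {P} {Q} (acc smaller) PRQ = weights-↭ P≼Q Q≼P
      where
      shrinks : ∀ {ζ P′} → P ─[ pre ζ ]→ P′ → size P′ < size P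
      shrinks t = ≤-reflexive (sym (size-fire t))

      P≼Q : MatchedBy P Q
      P≼Q t with R-sim PRQ t
      ... | Q′ , u , P′RQ′ = Q′ , u , bisimilar⇒weights-↭ (smaller (shrinks t)) P′RQ′

      Q≼P : MatchedBy Q P
      Q≼P u with R-sim (R-sym PRQ) u
      ... | P′ , t , Q′RP′ = P′ , t , ↭-sym (bisimilar⇒weights-↭ (smaller (shrinks t)) (R-sym Q′RP′))

lemma4p3 : (P Q : Proc) → P ∼ Q → (η : Prefix) → c η P ≡ c η Q
lemma4p3 P Q (R , R-sym , R-sim , PRQ) η =
  c-≡ P Q (bisimilar⇒weights-↭ R-sym R-sim (wellFounded size <-wellFounded P) PRQ)
  where open Weights η
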